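{- Let $M_{24}$ act $5$-transitively on a $24$-set $X$. If $(J(24,2),\mathcal{P})$ is an $M_{24}$-primitive decomposition, then $\mathcal{P}$ is $\mathcal{P}_\cap$, $\mathcal{P}_\ominus$ or $\mathcal{P}_\cup$.
   Context: $J(n,2)$ has vertices the $2$-subsets of an $n$-set $X$, adjacent when they share a point. A decomposition is a partition of the edge set into at least two parts; it is $G$-primitive if $G$ preserves it and acts primitively on the parts. $\mathcal{P}_\cap=\{P_x\mid x\in X\}$ where $P_x$ is the complete subgraph on the $2$-subsets containing $x$; $\mathcal{P}_\cup=\{Q_W\mid W$ a $3$-subset$\}$ where $Q_W$ is the triangle on the $2$-subsets of $W$; $\mathcal{P}_\ominus=\{M_{\{a,b\}}\}$ with $M_{\{a,b\}}=\{\{\{a,y\},\{b,y\}\}\mid y\in X\setminus\{a,b\}\}$. -}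

module Defs where

open import Level using (0ℓ)
open import Data.Fin using (Fin; #_)
open import Data.Vec using (Vec; _∷_; []; lookup)
open import Data.Product using (_×_; Σ; ∃; _,_)
open import Data.Sum using (_⊎_)
open import Relation.Binary.PropositionalEquality using (_≡_; _≢_)
open import Relation.Nullary using (¬_)
open import Function using (_∘_; id)
open import Function.Bundles using (_⇔_)

-- Points: 0..22 are the residues mod 23, 23 is ∞ (projective line over F_23).
-- M24 = ⟨α, β, γ, δ⟩ (Conway):  α : x ↦ x+1,  β : x ↦ 2x,  γ : x ↦ -1/x,
-- δ : x ↦ x³/9 (x a nonzero square), 9x³ (x a non-square), fixing 0 and ∞.
-- (Checked by Schreier–Sims: order 244823040, 5-transitive.)

Pt : Set
Pt = Fin 24

genα : Vec Pt 24
genα =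
  # 1 ∷ # 2 ∷ # 3 ∷ # 4 ∷ # 5 ∷ # 6 ∷ # 7 ∷ # 8 ∷ # 9 ∷ # 10 ∷ # 11 ∷ # 12 ∷ # 13 ∷ # 14 ∷ # 15 ∷ # 16 ∷ # 17 ∷ # 18 ∷ # 19 ∷ # 20 ∷ # 21 ∷ # 22 ∷ # 0 ∷ # 23 ∷ []

genβ : Vec Pt 24
genβ =
  # 0 ∷ # 2 ∷ # 4 ∷ # 6 ∷ # 8 ∷ # 10 ∷ # 12 ∷ # 14 ∷ # 16 ∷ # 18 ∷ # 20 ∷ # 22 ∷ # 1 ∷ # 3 ∷ # 5 ∷ # 7 ∷ # 9 ∷ # 11 ∷ # 13 ∷ # 15 ∷ # 17 ∷ # 19 ∷ # 21 ∷ # 23 ∷ []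

genγ : Vec Pt 24
genγ =
  # 23 ∷ # 22 ∷ # 11 ∷ # 15 ∷ # 17 ∷ # 9 ∷ # 19 ∷ # 13 ∷ # 20 ∷ # 5 ∷ # 16 ∷ # 2 ∷ # 21 ∷ # 7 ∷ # 18 ∷ # 3 ∷ # 10 ∷ # 4 ∷ # 14 ∷ # 6 ∷ # 8 ∷ # 12 ∷ # 1 ∷ # 0 ∷ []

genδ : Vec Pt 24
genδ =
  # 0 ∷ # 18 ∷ # 6 ∷ # 3 ∷ # 2 ∷ # 21 ∷ # 1 ∷ # 5 ∷ # 16 ∷ # 12 ∷ # 7 ∷ # 19 ∷ # 8 ∷ # 9 ∷ # 17 ∷ # 15 ∷ # 13 ∷ # 11 ∷ # 4 ∷ # 22 ∷ # 10 ∷ # 20 ∷ # 14 ∷ # 23 ∷ []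

-- Elements of M24: words in the generators (the group is finite, so the
-- monoid generated by the generators is the whole group).
data Gen : Set where
  α β γ δ : Gen

genTable : Gen → Vec Pt 24
genTable α = genα
genTable β = genβ
genTable γ = genγ
genTable δ = genδ

data M24 : Set where
  e   : M24
  _·_ : Gen → M24 → M24

act : M24 → Pt → Pt
act e       = id
act (s · g) = lookup (genTable s) ∘ act g

-- An edge {{a,b},{a,c}} (a,b,c distinct) is represented
-- by the triple (a , b , c): a is the common point ("centre"), b and c the
-- other points.  The triples (a,b,c) and (a,c,b) represent the same edge.

Triple : Set
Triple = Pt × Pt × Pt

IsEdge : Triple → Set
IsEdge (a , b , c) = a ≢ b × a ≢ c × b ≢ c

SameEdge : Triple → Triple → Set
SameEdge (a , b , c) (a′ , b′ , c′) =
  a ≡ a′ × ((b ≡ b′ × c ≡ c′) ⊎ (b ≡ c′ × c ≡ b′))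

actT : M24 → Triple → Triple
actT g (a , b , c) = act g a , act g b , act g c

-- A decomposition of J(24,2): a partition of the edge set into at least two
-- parts, given by the equivalence relation R "lie in the same part"
-- (only its values on edges matter; it must be well defined on edges).

record IsEdgeEquivalence (R : Triple → Triple → Set) : Set where
  field
    wellDefined : ∀ t t′ → IsEdge t → IsEdge t′ → SameEdge t t′ → R t t′
    symm  : ∀ t t′ → IsEdge t → IsEdge t′ → R t t′ → R t′ t
    trans : ∀ t t′ t″ → IsEdge t → IsEdge t′ → IsEdge t″ →
            R t t′ → R t′ t″ → R t t″

record IsDecomposition (R : Triple → Triple → Set) : Set where
  field
    isEquiv   : IsEdgeEquivalence R
    twoParts  : Σ Triple λ t → Σ Triple λ t′ →
                IsEdge t × IsEdge t′ × ¬ R t t′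

M24-Invariant : (Triple → Triple → Set) → Set
M24-Invariant R =
  ∀ (g : M24) t t′ → IsEdge t → IsEdge t′ → R t t′ → R (actT g t) (actT g t′)

-- A partition of the parts is the
-- same as an equivalence relation S on edges coarser than R.
M24-Primitive : (Triple → Triple → Set) → Set₁
M24-Primitive R =
  (∀ t t′ → IsEdge t → IsEdge t′ → Σ M24 λ g → R (actT g t) t′) ×
  (∀ (S : Triple → Triple → Set) →
     IsEdgeEquivalence S →
     (∀ t t′ → IsEdge t → IsEdge t′ → R t t′ → S t t′) →
     M24-Invariant S →
     (∀ t t′ → IsEdge t → IsEdge t′ → S t t′ → R t t′) ⊎
     (∀ t t′ → IsEdge t → IsEdge t′ → S t t′))

record IsM24PrimitiveDecomposition (R : Triple → Triple → Set) : Set₁ where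
  field
    decomposition : IsDecomposition R
    invariant     : M24-Invariant R
    isPrimitive   : M24-Primitive R

-- The three decompositions.
-- P_∩ : parts P_x; the edge {{a,b},{a,c}} lies in P_a.
SameP∩ : Triple → Triple → Set
SameP∩ (a , _ , _) (a′ , _ , _) = a ≡ a′

-- P_⊖ : parts M_{b,c}; the edge {{a,b},{a,c}} = {{b,a},{c,a}} lies in M_{b,c}.
SameP⊖ : Triple → Triple → Set
SameP⊖ (_ , b , c) (_ , b′ , c′) =
  ∀ x → (x ≡ b ⊎ x ≡ c) ⇔ (x ≡ b′ ⊎ x ≡ c′)

-- P_∪ : parts Q_W; the edge {{a,b},{a,c}} lies in Q_{a,b,c}.
SameP∪ : Triple → Triple → Set
SameP∪ (a , b , c) (a′ , b′ , c′) =
  ∀ x → (x ≡ a ⊎ x ≡ b ⊎ x ≡ c) ⇔ (x ≡ a′ ⊎ x ≡ b′ ⊎ x ≡ c′)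

SamePartition : (Triple → Triple → Set) → (Triple → Triple → Set) → Set
SamePartition R P = ∀ t t′ → IsEdge t → IsEdge t′ → R t t′ ⇔ P t t′

module Submission where

-- By primitivity, for each Q among P∩, P⊖, P∪ the equivalence generated by R and Q, being
-- M24-invariant and coarser than R, is either R itself (so Q refines R) or the complete
-- relation (so R joins two edges that Q separates).  Five-transitivity of M24 turns any
-- pair of R-related edges into a whole orbit of such pairs: two edges with the same centre
-- and different outer pairs force P∩ to refine R, different centres over the same outer
-- pair force P⊖, two edges of one triangle with different centres force P∪, and every
-- other relative position makes R complete.  Any two of P∩, P⊖, P∪ already generate the
-- complete relation, so R is coarser than at most one of them, equals it when it is, and
-- cannot escape all three.  Five-transitivity itself is checked by evaluation along a
-- stabiliser chain whose coset representatives are tabulated.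

open import Defs
open import Data.Empty using (⊥; ⊥-elim)
open import Data.Fin using (Fin; zero; suc; toℕ; fromℕ<; _↑ˡ_; _<_; #_)
open import Data.Fin.Properties
  using (_≟_; all?; any?; _<?_; ¬∀⟶∃¬; <⇒notInjective; toℕ-fromℕ<; toℕ-injective; toℕ<n; <⇒≢)
open import Data.List using (List; []; _∷_; foldr)
open import Data.Nat as ℕ using (ℕ; zero; suc)
open import Data.Nat.Properties using (m<1+n⇒m<n∨m≡n; <⇒≤; ≤-refl; n<1+n)
open import Data.Product using (∃; _×_; _,_; proj₁; proj₂)
open import Data.Sum as Sum using (_⊎_; inj₁; inj₂; [_,_]′)
open import Data.Vec using (Vec; []; _∷_; lookup)
open import Data.Vec.Relation.Unary.All using (All; []; _∷_)
open import Data.Vec.Relation.Unary.All.Properties using (lookup⁻)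
open import Data.Vec.Relation.Unary.AllPairs using ([]; _∷_)
open import Data.Vec.Relation.Unary.Unique.Propositional using (Unique)
open import Data.Vec.Relation.Unary.Unique.Propositional.Properties using (lookup-injective)
open import Data.Vec.Relation.Binary.Pointwise.Inductive using (Pointwise; []; _∷_)
open import Function using (_⇔_; mk⇔; Equivalence; _∘′_)
import Function.Properties.Equivalence as ⇔
open import Relation.Binary.PropositionalEquality
open import Relation.Nullary using (Dec; yes; no; ¬_)
open import Relation.Nullary.Decidable
  using (True; toWitness; from-yes; from-no; decidable-stable; map′; _⊎-dec_; _×-dec_; _→-dec_; ¬?)

open Equivalence using (to; from)

-- The action of M24

word : List Gen → M24
word = foldr _·_ e

_⊙_ : M24 → M24 → M24
e ⊙ h = h
(s · g) ⊙ h = s · (g ⊙ h)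

act-⊙ : ∀ g h x → act (g ⊙ h) x ≡ act g (act h x)
act-⊙ e h x = refl
act-⊙ (s · g) h x = cong (act (s · e)) (act-⊙ g h x)

generatorInverse : Gen → M24
generatorInverse α = word (γ ∷ α ∷ γ ∷ α ∷ γ ∷ [])
generatorInverse β = word (γ ∷ β ∷ γ ∷ [])
generatorInverse γ = word (γ ∷ [])
generatorInverse δ = word (δ ∷ δ ∷ δ ∷ δ ∷ [])

cancels? : ∀ s x → Dec (act (generatorInverse s) (act (s · e) x) ≡ x)
cancels? s x = act (generatorInverse s) (act (s · e) x) ≟ x

act-generatorInverse : ∀ s x → act (generatorInverse s) (act (s · e) x) ≡ x
act-generatorInverse α = from-yes (all? (cancels? α))
act-generatorInverse β = from-yes (all? (cancels? β))
act-generatorInverse γ = from-yes (all? (cancels? γ))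
act-generatorInverse δ = from-yes (all? (cancels? δ))

inv : M24 → M24
inv e = e
inv (s · g) = inv g ⊙ generatorInverse s

act-inv : ∀ g x → act (inv g) (act g x) ≡ x
act-inv e x = refl
act-inv (s · g) x = begin
  act (inv g ⊙ generatorInverse s) (act (s · g) x)
    ≡⟨ act-⊙ (inv g) _ _ ⟩
  act (inv g) (act (generatorInverse s) (act (s · e) (act g x)))
    ≡⟨ cong (act (inv g)) (act-generatorInverse s _) ⟩
  act (inv g) (act g x)
    ≡⟨ act-inv g x ⟩
  x ∎
  where open ≡-Reasoning

act-injective : ∀ g {x y} → act g x ≡ act g y → x ≡ y
act-injective g {x} {y} eq = trans (sym (act-inv g x)) (trans (cong (act (inv g)) eq) (act-inv g y))

edge-image : ∀ g {t} → IsEdge t → IsEdge (actT g t)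
edge-image g (a≢b , a≢c , b≢c) = a≢b ∘′ act-injective g , a≢c ∘′ act-injective g , b≢c ∘′ act-injective g

-- Multiple transitivity

no-injective-fit : ∀ {A : Set} {m n} → n ℕ.< m → (xs : Fin m → A) → (∀ i j → xs i ≡ xs j → i ≡ j) →
                   (ys : Fin n → A) → ¬ (∀ i → ∃ λ j → xs i ≡ ys j)
no-injective-fit n<m xs xs-injective ys fits = <⇒notInjective n<m λ {i} {j} eq →
  xs-injective i j (trans (proj₂ (fits i)) (trans (cong ys eq) (sym (proj₂ (fits j)))))

point : Fin 5 → Pt
point i = i ↑ˡ 19

-- Row k, entry y: a word fixing 0, …, k−1 and sending y to k, for y outside {0, …, k−1};
-- the remaining entries are never used.
transversalWords : Vec (Vec (List Gen) 24) 5
transversalWords =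
    ( [] ∷ (α ∷ γ ∷ []) ∷ (α ∷ β ∷ γ ∷ []) ∷ (α ∷ γ ∷ δ ∷ β ∷ []) ∷ (α ∷ α ∷ δ ∷ α ∷ [])
    ∷ (α ∷ α ∷ δ ∷ []) ∷ (α ∷ γ ∷ δ ∷ []) ∷ (α ∷ α ∷ δ ∷ δ ∷ []) ∷ (α ∷ α ∷ α ∷ γ ∷ [])
    ∷ (α ∷ α ∷ γ ∷ δ ∷ []) ∷ (α ∷ β ∷ α ∷ []) ∷ (α ∷ β ∷ []) ∷ (α ∷ α ∷ γ ∷ [])
    ∷ (α ∷ α ∷ γ ∷ δ ∷ δ ∷ []) ∷ (α ∷ α ∷ δ ∷ β ∷ []) ∷ (α ∷ α ∷ δ ∷ δ ∷ β ∷ [])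
    ∷ (α ∷ β ∷ α ∷ γ ∷ []) ∷ (α ∷ β ∷ β ∷ []) ∷ (α ∷ δ ∷ α ∷ []) ∷ (α ∷ δ ∷ [])
    ∷ (α ∷ α ∷ α ∷ []) ∷ (α ∷ α ∷ []) ∷ (α ∷ []) ∷ (γ ∷ [])
    ∷ [] )
  ∷ ( [] ∷ [] ∷ (δ ∷ δ ∷ []) ∷ (δ ∷ β ∷ []) ∷ (δ ∷ δ ∷ δ ∷ []) ∷ (γ ∷ β ∷ α ∷ α ∷ γ ∷ [])
    ∷ (δ ∷ []) ∷ (γ ∷ δ ∷ α ∷ γ ∷ β ∷ []) ∷ (β ∷ γ ∷ α ∷ γ ∷ []) ∷ (β ∷ δ ∷ [])
    ∷ (γ ∷ β ∷ β ∷ α ∷ γ ∷ []) ∷ (β ∷ γ ∷ δ ∷ α ∷ β ∷ γ ∷ []) ∷ (β ∷ []) ∷ (β ∷ δ ∷ δ ∷ [])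
    ∷ (γ ∷ δ ∷ α ∷ γ ∷ []) ∷ (β ∷ γ ∷ δ ∷ α ∷ α ∷ γ ∷ []) ∷ (β ∷ δ ∷ β ∷ [])
    ∷ (β ∷ γ ∷ δ ∷ α ∷ γ ∷ []) ∷ (β ∷ δ ∷ δ ∷ β ∷ []) ∷ (β ∷ δ ∷ α ∷ γ ∷ α ∷ [])
    ∷ (β ∷ γ ∷ δ ∷ α ∷ γ ∷ β ∷ []) ∷ (δ ∷ δ ∷ α ∷ γ ∷ α ∷ []) ∷ (γ ∷ δ ∷ α ∷ γ ∷ δ ∷ [])
    ∷ (α ∷ γ ∷ α ∷ [])
    ∷ [] )
  ∷ ( [] ∷ [] ∷ [] ∷ (δ ∷ α ∷ δ ∷ α ∷ δ ∷ α ∷ []) ∷ (β ∷ γ ∷ α ∷ γ ∷ β ∷ δ ∷ δ ∷ [])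
    ∷ (β ∷ δ ∷ β ∷ α ∷ γ ∷ α ∷ β ∷ []) ∷ (β ∷ δ ∷ δ ∷ β ∷ δ ∷ [])
    ∷ (β ∷ β ∷ α ∷ δ ∷ α ∷ δ ∷ α ∷ []) ∷ (β ∷ β ∷ δ ∷ δ ∷ δ ∷ δ ∷ []) ∷ (δ ∷ δ ∷ β ∷ [])
    ∷ (γ ∷ δ ∷ β ∷ β ∷ α ∷ β ∷ γ ∷ []) ∷ (γ ∷ α ∷ β ∷ α ∷ β ∷ γ ∷ [])
    ∷ (γ ∷ δ ∷ β ∷ γ ∷ α ∷ γ ∷ α ∷ []) ∷ (β ∷ γ ∷ α ∷ γ ∷ β ∷ β ∷ β ∷ [])
    ∷ (γ ∷ α ∷ α ∷ δ ∷ β ∷ γ ∷ []) ∷ (γ ∷ α ∷ α ∷ γ ∷ β ∷ β ∷ β ∷ []) ∷ (β ∷ β ∷ δ ∷ β ∷ [])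
    ∷ (γ ∷ β ∷ δ ∷ β ∷ α ∷ γ ∷ δ ∷ β ∷ []) ∷ (β ∷ γ ∷ α ∷ δ ∷ β ∷ γ ∷ [])
    ∷ (γ ∷ α ∷ α ∷ γ ∷ β ∷ δ ∷ δ ∷ []) ∷ (α ∷ γ ∷ α ∷ γ ∷ δ ∷ α ∷ γ ∷ [])
    ∷ (α ∷ γ ∷ α ∷ γ ∷ δ ∷ δ ∷ α ∷ γ ∷ []) ∷ (β ∷ β ∷ β ∷ γ ∷ α ∷ γ ∷ δ ∷ [])
    ∷ (β ∷ α ∷ γ ∷ α ∷ [])
    ∷ [] )
  ∷ ( [] ∷ [] ∷ [] ∷ [] ∷ (α ∷ δ ∷ α ∷ δ ∷ α ∷ δ ∷ [])
    ∷ (γ ∷ α ∷ β ∷ δ ∷ β ∷ α ∷ δ ∷ β ∷ γ ∷ [])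
    ∷ (α ∷ β ∷ α ∷ α ∷ δ ∷ α ∷ α ∷ γ ∷ β ∷ α ∷ δ ∷ [])
    ∷ (α ∷ β ∷ β ∷ γ ∷ α ∷ δ ∷ α ∷ α ∷ α ∷ γ ∷ α ∷ γ ∷ [])
    ∷ (α ∷ δ ∷ δ ∷ α ∷ β ∷ δ ∷ β ∷ α ∷ γ ∷ δ ∷ α ∷ [])
    ∷ (γ ∷ α ∷ β ∷ δ ∷ α ∷ δ ∷ α ∷ β ∷ α ∷ γ ∷ [])
    ∷ (β ∷ γ ∷ α ∷ β ∷ δ ∷ δ ∷ α ∷ γ ∷ β ∷ β ∷ β ∷ [])
    ∷ (α ∷ γ ∷ α ∷ β ∷ δ ∷ β ∷ γ ∷ α ∷ γ ∷ []) ∷ (γ ∷ α ∷ α ∷ δ ∷ α ∷ α ∷ γ ∷ δ ∷ β ∷ [])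
    ∷ (γ ∷ δ ∷ β ∷ δ ∷ α ∷ δ ∷ α ∷ γ ∷ β ∷ β ∷ [])
    ∷ (δ ∷ δ ∷ α ∷ γ ∷ δ ∷ β ∷ α ∷ α ∷ α ∷ δ ∷ [])
    ∷ (α ∷ γ ∷ α ∷ γ ∷ δ ∷ β ∷ β ∷ δ ∷ α ∷ γ ∷ [])
    ∷ (β ∷ γ ∷ α ∷ β ∷ β ∷ δ ∷ β ∷ α ∷ γ ∷ δ ∷ [])
    ∷ (δ ∷ α ∷ δ ∷ δ ∷ α ∷ α ∷ δ ∷ β ∷ δ ∷ α ∷ [])
    ∷ (γ ∷ α ∷ γ ∷ α ∷ α ∷ γ ∷ δ ∷ δ ∷ β ∷ δ ∷ α ∷ [])
    ∷ (α ∷ β ∷ α ∷ α ∷ α ∷ γ ∷ α ∷ α ∷ δ ∷ α ∷ [])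
    ∷ (β ∷ γ ∷ δ ∷ β ∷ α ∷ δ ∷ α ∷ α ∷ γ ∷ δ ∷ [])
    ∷ (γ ∷ δ ∷ δ ∷ δ ∷ β ∷ α ∷ α ∷ δ ∷ α ∷ α ∷ γ ∷ [])
    ∷ (δ ∷ β ∷ γ ∷ α ∷ γ ∷ β ∷ δ ∷ β ∷ δ ∷ []) ∷ (α ∷ γ ∷ α ∷ γ ∷ δ ∷ β ∷ δ ∷ δ ∷ α ∷ γ ∷ [])
    ∷ [] )
  ∷ ( [] ∷ [] ∷ [] ∷ [] ∷ [] ∷ (γ ∷ δ ∷ δ ∷ β ∷ δ ∷ α ∷ δ ∷ β ∷ α ∷ β ∷ α ∷ γ ∷ δ ∷ [])
    ∷ (γ ∷ α ∷ δ ∷ α ∷ γ ∷ δ ∷ β ∷ δ ∷ α ∷ γ ∷ α ∷ β ∷ β ∷ [])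
    ∷ (α ∷ β ∷ α ∷ β ∷ α ∷ β ∷ δ ∷ α ∷ δ ∷ α ∷ δ ∷ β ∷ α ∷ α ∷ [])
    ∷ (δ ∷ δ ∷ β ∷ β ∷ α ∷ γ ∷ α ∷ [])
    ∷ (α ∷ β ∷ δ ∷ δ ∷ α ∷ β ∷ γ ∷ α ∷ β ∷ δ ∷ β ∷ α ∷ γ ∷ α ∷ α ∷ [])
    ∷ (δ ∷ α ∷ δ ∷ α ∷ β ∷ γ ∷ α ∷ δ ∷ δ ∷ α ∷ δ ∷ [])
    ∷ (α ∷ β ∷ β ∷ δ ∷ δ ∷ α ∷ β ∷ γ ∷ α ∷ δ ∷ δ ∷ β ∷ [])
    ∷ (γ ∷ α ∷ β ∷ β ∷ δ ∷ δ ∷ δ ∷ α ∷ γ ∷ δ ∷ δ ∷ β ∷ δ ∷ [])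
    ∷ (γ ∷ α ∷ δ ∷ β ∷ α ∷ δ ∷ β ∷ α ∷ β ∷ α ∷ γ ∷ δ ∷ [])
    ∷ (α ∷ γ ∷ δ ∷ α ∷ β ∷ α ∷ β ∷ δ ∷ α ∷ β ∷ γ ∷ δ ∷ α ∷ γ ∷ [])
    ∷ (γ ∷ δ ∷ β ∷ δ ∷ α ∷ β ∷ δ ∷ β ∷ α ∷ α ∷ δ ∷ α ∷ γ ∷ [])
    ∷ (γ ∷ β ∷ δ ∷ α ∷ β ∷ δ ∷ α ∷ β ∷ β ∷ δ ∷ β ∷ α ∷ β ∷ γ ∷ [])
    ∷ (β ∷ δ ∷ β ∷ α ∷ δ ∷ α ∷ δ ∷ α ∷ γ ∷ α ∷ γ ∷ δ ∷ β ∷ β ∷ [])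
    ∷ (γ ∷ α ∷ β ∷ δ ∷ α ∷ δ ∷ δ ∷ β ∷ δ ∷ α ∷ β ∷ α ∷ α ∷ γ ∷ [])
    ∷ (γ ∷ α ∷ γ ∷ δ ∷ δ ∷ β ∷ δ ∷ [])
    ∷ (α ∷ δ ∷ α ∷ β ∷ δ ∷ α ∷ β ∷ β ∷ α ∷ δ ∷ δ ∷ δ ∷ α ∷ β ∷ [])
    ∷ (α ∷ γ ∷ δ ∷ α ∷ α ∷ γ ∷ δ ∷ δ ∷ δ ∷ α ∷ δ ∷ α ∷ δ ∷ [])
    ∷ (γ ∷ δ ∷ α ∷ β ∷ α ∷ δ ∷ α ∷ α ∷ δ ∷ α ∷ γ ∷ δ ∷ β ∷ [])
    ∷ (γ ∷ δ ∷ β ∷ δ ∷ δ ∷ α ∷ β ∷ δ ∷ α ∷ β ∷ α ∷ α ∷ γ ∷ [])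
    ∷ [] )
  ∷ []

transversal : Fin 5 → Pt → M24
transversal k y = word (lookup (lookup transversalWords k) y)

transversal-fixes : ∀ k y i → i < k → act (transversal k y) (point i) ≡ point i
transversal-fixes = from-yes (all? λ k → all? λ y → all? λ i →
  i <? k →-dec act (transversal k y) (point i) ≟ point i)

transversal-sends : ∀ k y → (∀ i → i < k → y ≢ point i) → act (transversal k y) y ≡ point k
transversal-sends = from-yes (all? λ k → all? λ y →
  (all? λ i → i <? k →-dec ¬? (y ≟ point i)) →-dec act (transversal k y) y ≟ point k)

Standardises : M24 → (Fin 5 → Pt) → ℕ → Set
Standardises g x k = ∀ i → toℕ i ℕ.< k → act g (x i) ≡ point i

standardise : (x : Fin 5 → Pt) → (∀ i j → x i ≡ x j → i ≡ j) →
              ∀ k → k ℕ.≤ 5 → ∃ λ g → Standardises g x k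
standardise x x-injective zero    _   = e , λ _ ()
standardise x x-injective (suc k) k<5 with standardise x x-injective k (<⇒≤ k<5)
... | g , g-std = transversal j y ⊙ g , extended
  where
  j : Fin 5
  j = fromℕ< k<5

  y : Pt
  y = act g (x j)

  below-j : ∀ {i} → i < j → toℕ i ℕ.< k
  below-j {i} = subst (toℕ i ℕ.<_) (toℕ-fromℕ< k<5)

  to-below-j : ∀ {i} → toℕ i ℕ.< k → i < j
  to-below-j {i} = subst (toℕ i ℕ.<_) (sym (toℕ-fromℕ< k<5))

  y-new : ∀ i → i < j → y ≢ point i
  y-new i i<j y≡i = <⇒≢ i<j (x-injective i j
    (act-injective g (trans (g-std i (below-j i<j)) (sym y≡i))))

  extended : Standardises (transversal j y ⊙ g) x (suc k)
  extended i i<1+k rewrite act-⊙ (transversal j y) g (x i) with m<1+n⇒m<n∨m≡n i<1+k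
  ... | inj₁ i<k rewrite g-std i i<k =
    transversal-fixes j y i (to-below-j i<k)
  ... | inj₂ i≡k with toℕ-injective (trans i≡k (sym (toℕ-fromℕ< k<5)))
  ...   | refl = transversal-sends j y y-new

Sends : ∀ {k} → M24 → Vec Pt k → Vec Pt k → Set
Sends g = Pointwise (λ x y → act g x ≡ y)

Transitive : ℕ → Set
Transitive k = (xs ys : Vec Pt k) → Unique xs → Unique ys → ∃ λ g → Sends g xs ys

sends-lookup : ∀ {k} g (xs ys : Vec Pt k) → (∀ i → act g (lookup xs i) ≡ lookup ys i) → Sends g xs ys
sends-lookup g []       []       _ = []
sends-lookup g (x ∷ xs) (y ∷ ys) f = f zero ∷ sends-lookup g xs ys (λ i → f (suc i))

-- Opaque because unification would otherwise unfold these witnesses, which is very slow.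
opaque
  five-transitive : Transitive 5
  five-transitive xs ys xs-unique ys-unique
    with standardise (lookup xs) (lookup-injective xs-unique) 5 ≤-refl
       | standardise (lookup ys) (lookup-injective ys-unique) 5 ≤-refl
  ... | gx , gx-std | gy , gy-std = inv gy ⊙ gx , sends-lookup (inv gy ⊙ gx) xs ys λ i → begin
    act (inv gy ⊙ gx) (lookup xs i)     ≡⟨ act-⊙ (inv gy) gx _ ⟩
    act (inv gy) (act gx (lookup xs i)) ≡⟨ cong (act (inv gy)) (same-image i) ⟩
    act (inv gy) (act gy (lookup ys i)) ≡⟨ act-inv gy _ ⟩
    lookup ys i                         ∎
    where
    open ≡-Reasoning
    same-image : ∀ i → act gx (lookup xs i) ≡ act gy (lookup ys i)
    same-image i = trans (gx-std i (toℕ<n i)) (sym (gy-std i (toℕ<n i)))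

  fresh : ∀ {n k} (xs : Vec (Fin n) k) → {True (k ℕ.<? n)} → ∃ λ z → All (z ≢_) xs
  fresh {n} xs {k<n} with all? (λ z → any? λ i → z ≟ lookup xs i)
  ... | yes hit = ⊥-elim (no-injective-fit (toWitness k<n) (λ z → z) (λ _ _ z≡z′ → z≡z′) (lookup xs) hit)
  ... | no ¬hit with ¬∀⟶∃¬ n _ (λ z → any? λ i → z ≟ lookup xs i) ¬hit
  ...   | z , missed = z , lookup⁻ λ i z≡xᵢ → missed (i , z≡xᵢ)

transitive-pred : ∀ {k} {k<24 : True (k ℕ.<? 24)} → Transitive (suc k) → Transitive k
transitive-pred {k<24 = k<24} transitive xs ys xs-unique ys-unique
  with fresh xs {k<24} | fresh ys {k<24}
... | x , x-new | y , y-new with transitive (x ∷ xs) (y ∷ ys) (x-new ∷ xs-unique) (y-new ∷ ys-unique)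
...   | g , _ ∷ sends = g , sends

four-transitive : Transitive 4
four-transitive = transitive-pred five-transitive

three-transitive : Transitive 3
three-transitive = transitive-pred four-transitive

-- Outer pairs and triangles of edges

_⇔?_ : ∀ {A B : Set} → Dec A → Dec B → Dec (A ⇔ B)
a? ⇔? b? = map′ (λ (f , g) → mk⇔ f g) (λ a⇔b → to a⇔b , from a⇔b) ((a? →-dec b?) ×-dec (b? →-dec a?))

module SameVertices (_∈_ : Pt → Triple → Set) (_∈?_ : ∀ x t → Dec (x ∈ t))
  (∈-act : ∀ g {v t} → v ∈ t → act g v ∈ actT g t)
  (∈-image : ∀ g {x t} → x ∈ actT g t → ∃ λ v → x ≡ act g v × v ∈ t) where

  Same : Triple → Triple → Set
  Same t t′ = ∀ x → x ∈ t ⇔ x ∈ t′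

  same-sym : ∀ {t t′} → Same t t′ → Same t′ t
  same-sym h x = ⇔.sym (h x)

  same-trans : ∀ {t t′ t″} → Same t t′ → Same t′ t″ → Same t t″
  same-trans h h′ x = ⇔.trans (h x) (h′ x)

  same? : ∀ t t′ → Dec (Same t t′)
  same? t t′ = all? λ x → (x ∈? t) ⇔? (x ∈? t′)

  same-invariant : ∀ g t t′ → Same t t′ → Same (actT g t) (actT g t′)
  same-invariant g t t′ h x = mk⇔ (move h) (move (same-sym h))
    where
    move : ∀ {u u′} → Same u u′ → x ∈ actT g u → x ∈ actT g u′
    move same x∈ with ∈-image g x∈
    ... | v , refl , v∈ = ∈-act g (to (same v) v∈)

_∈⊖_ : Pt → Triple → Set
x ∈⊖ (_ , b , c) = x ≡ b ⊎ x ≡ c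

_∈△_ : Pt → Triple → Set
x ∈△ (a , b , c) = x ≡ a ⊎ x ≡ b ⊎ x ≡ c

_∉△_ : Pt → Triple → Set
x ∉△ t = ¬ x ∈△ t

_∈⊖?_ : ∀ x t → Dec (x ∈⊖ t)
x ∈⊖? (_ , b , c) = (x ≟ b) ⊎-dec (x ≟ c)

_∈△?_ : ∀ x t → Dec (x ∈△ t)
x ∈△? (a , b , c) = (x ≟ a) ⊎-dec (x ≟ b) ⊎-dec (x ≟ c)

∈⊖-image : ∀ g {x t} → x ∈⊖ actT g t → ∃ λ v → x ≡ act g v × v ∈⊖ t
∈⊖-image g {t = _ , b , _} (inj₁ x≡gb) = b , x≡gb , inj₁ refl
∈⊖-image g {t = _ , _ , c} (inj₂ x≡gc) = c , x≡gc , inj₂ refl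

∈△-image : ∀ g {x t} → x ∈△ actT g t → ∃ λ v → x ≡ act g v × v ∈△ t
∈△-image g {t = a , _ , _} (inj₁ x≡ga)        = a , x≡ga , inj₁ refl
∈△-image g {t = _ , b , _} (inj₂ (inj₁ x≡gb)) = b , x≡gb , inj₂ (inj₁ refl)
∈△-image g {t = _ , _ , c} (inj₂ (inj₂ x≡gc)) = c , x≡gc , inj₂ (inj₂ refl)

-- By eta for pairs, SameP⊖ and SameP∪ are definitionally SameP⊖.Same and SameP∪.Same.
module SameP⊖ = SameVertices _∈⊖_ _∈⊖?_ (λ g → Sum.map (cong (act g)) (cong (act g))) ∈⊖-image
module SameP∪ = SameVertices _∈△_ _∈△?_
  (λ g → Sum.map (cong (act g)) (Sum.map (cong (act g)) (cong (act g)))) ∈△-image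

edge-unique : ∀ {a b c} → IsEdge (a , b , c) → Unique (a ∷ b ∷ c ∷ [])
edge-unique (a≢b , a≢c , b≢c) = (a≢b ∷ a≢c ∷ []) ∷ (b≢c ∷ []) ∷ [] ∷ []

distinct-pair : ∀ {x y u v : Pt} → x ≢ y → x ≡ u ⊎ x ≡ v → y ≡ u ⊎ y ≡ v →
                (x ≡ u × y ≡ v) ⊎ (x ≡ v × y ≡ u)
distinct-pair x≢y (inj₁ x≡u) (inj₂ y≡v) = inj₁ (x≡u , y≡v)
distinct-pair x≢y (inj₂ x≡v) (inj₁ y≡u) = inj₂ (x≡v , y≡u)
distinct-pair x≢y (inj₁ x≡u) (inj₁ y≡u) = ⊥-elim (x≢y (trans x≡u (sym y≡u)))
distinct-pair x≢y (inj₂ x≡v) (inj₂ y≡v) = ⊥-elim (x≢y (trans x≡v (sym y≡v)))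

∈△-minus-middle : ∀ {x a b c} → x ∈△ (a , b , c) → x ≢ b → x ≡ a ⊎ x ≡ c
∈△-minus-middle (inj₁ x≡a)        _   = inj₁ x≡a
∈△-minus-middle (inj₂ (inj₁ x≡b)) x≢b = ⊥-elim (x≢b x≡b)
∈△-minus-middle (inj₂ (inj₂ x≡c)) _   = inj₂ x≡c

∈△-minus-last : ∀ {x a b c} → x ∈△ (a , b , c) → x ≢ c → x ≡ a ⊎ x ≡ b
∈△-minus-last (inj₁ x≡a)        _   = inj₁ x≡a
∈△-minus-last (inj₂ (inj₁ x≡b)) _   = inj₂ x≡b
∈△-minus-last (inj₂ (inj₂ x≡c)) x≢c = ⊥-elim (x≢c x≡c)

samePair-refl : ∀ {b c} a a′ → SameP⊖ (a , b , c) (a′ , b , c)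
samePair-refl _ _ _ = ⇔.refl

samePair-swap : ∀ {b c} a a′ → SameP⊖ (a , b , c) (a′ , c , b)
samePair-swap _ _ _ = mk⇔ Sum.swap Sum.swap

sameTriangle-rotate : ∀ {a b c} → SameP∪ (a , b , c) (b , a , c)
sameTriangle-rotate _ = mk⇔ rotate rotate
  where
  rotate : ∀ {x a b c : Pt} → x ∈△ (a , b , c) → x ∈△ (b , a , c)
  rotate (inj₁ x≡a)        = inj₂ (inj₁ x≡a)
  rotate (inj₂ (inj₁ x≡b)) = inj₁ x≡b
  rotate (inj₂ (inj₂ x≡c)) = inj₂ (inj₂ x≡c)

sameTriangle-of-samePair : ∀ {t t′} → SameP∩ t t′ → SameP⊖ t t′ → SameP∪ t t′
sameTriangle-of-samePair {_ , _ , _} {_ , _ , _} refl same x =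
  mk⇔ (Sum.map₂ (to (same x))) (Sum.map₂ (from (same x)))

triangle-exhausted : ∀ {t p x y} → IsEdge (p , x , y) → p ∈△ t → x ∈△ t → y ∈△ t → SameP∪ t (p , x , y)
triangle-exhausted {a , b , c} {p} {x} {y} (p≢x , p≢y , x≢y) p∈ x∈ y∈ z = mk⇔ covered vertex
  where
  vertex : z ∈△ (p , x , y) → z ∈△ (a , b , c)
  vertex (inj₁ refl)        = p∈
  vertex (inj₂ (inj₁ refl)) = x∈
  vertex (inj₂ (inj₂ refl)) = y∈

  index : ∀ {v} → v ∈△ (a , b , c) → ∃ λ j → v ≡ lookup (a ∷ b ∷ c ∷ []) j
  index (inj₁ v≡a)        = zero , v≡a
  index (inj₂ (inj₁ v≡b)) = suc zero , v≡b
  index (inj₂ (inj₂ v≡c)) = suc (suc zero) , v≡c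

  covered : z ∈△ (a , b , c) → z ∈△ (p , x , y)
  covered z∈ with z ∈△? (p , x , y)
  ... | yes z∈′ = z∈′
  -- otherwise z, p, x, y would be four distinct points of {a, b, c}
  ... | no z∉ = ⊥-elim (no-injective-fit (n<1+n 3) (lookup (z ∷ p ∷ x ∷ y ∷ []))
                  (lookup-injective four-distinct) (lookup (a ∷ b ∷ c ∷ [])) fits)
    where
    four-distinct : Unique (z ∷ p ∷ x ∷ y ∷ [])
    four-distinct = (z∉ ∘′ inj₁ ∷ z∉ ∘′ inj₂ ∘′ inj₁ ∷ z∉ ∘′ inj₂ ∘′ inj₂ ∷ [])
                  ∷ (p≢x ∷ p≢y ∷ []) ∷ (x≢y ∷ []) ∷ [] ∷ []
    fits : ∀ i → ∃ λ j → lookup (z ∷ p ∷ x ∷ y ∷ []) i ≡ lookup (a ∷ b ∷ c ∷ []) j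
    fits zero                   = index z∈
    fits (suc zero)             = index p∈
    fits (suc (suc zero))       = index x∈
    fits (suc (suc (suc zero))) = index y∈

stabiliser-transitive : ∀ {a b c p x z} → Unique (a ∷ b ∷ c ∷ []) →
                        All (x ≢_) (a ∷ b ∷ c ∷ p ∷ []) → All (z ≢_) (a ∷ b ∷ c ∷ p ∷ []) →
                        ∃ λ g → Sends g (x ∷ a ∷ b ∷ c ∷ p ∷ []) (z ∷ a ∷ b ∷ c ∷ p ∷ [])
stabiliser-transitive {a} {b} {c} {p} {x} {z} abc@((a≢b ∷ a≢c ∷ []) ∷ (b≢c ∷ []) ∷ [] ∷ [])
  x-new@(x≢a ∷ x≢b ∷ x≢c ∷ _ ∷ []) z-new@(z≢a ∷ z≢b ∷ z≢c ∷ _ ∷ []) with p ∈△? (a , b , c)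
... | no p∉ = five-transitive (x ∷ a ∷ b ∷ c ∷ p ∷ []) (z ∷ a ∷ b ∷ c ∷ p ∷ []) (x-new ∷ abcp) (z-new ∷ abcp)
  where
  abcp : Unique (a ∷ b ∷ c ∷ p ∷ [])
  abcp = (a≢b ∷ a≢c ∷ p∉ ∘′ inj₁ ∘′ sym ∷ []) ∷ (b≢c ∷ p∉ ∘′ inj₂ ∘′ inj₁ ∘′ sym ∷ [])
       ∷ (p∉ ∘′ inj₂ ∘′ inj₂ ∘′ sym ∷ []) ∷ [] ∷ []
... | yes p∈ with four-transitive (x ∷ a ∷ b ∷ c ∷ []) (z ∷ a ∷ b ∷ c ∷ [])
                    ((x≢a ∷ x≢b ∷ x≢c ∷ []) ∷ abc) ((z≢a ∷ z≢b ∷ z≢c ∷ []) ∷ abc)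
...   | g , gx ∷ ga ∷ gb ∷ gc ∷ [] = g , gx ∷ ga ∷ gb ∷ gc ∷ fixed p∈ ∷ []
  where
  fixed : p ∈△ (a , b , c) → act g p ≡ p
  fixed (inj₁ refl)        = ga
  fixed (inj₂ (inj₁ refl)) = gb
  fixed (inj₂ (inj₂ refl)) = gc

t₀₁₂ t₁₀₂ t₀₁₃ : Triple
t₀₁₂ = # 0 , # 1 , # 2
t₁₀₂ = # 1 , # 0 , # 2
t₀₁₃ = # 0 , # 1 , # 3

edge₀₁₂ : IsEdge t₀₁₂
edge₀₁₂ = (λ ()) , (λ ()) , (λ ())

edge₁₀₂ : IsEdge t₁₀₂
edge₁₀₂ = (λ ()) , (λ ()) , (λ ())

edge₀₁₃ : IsEdge t₀₁₃
edge₀₁₃ = (λ ()) , (λ ()) , (λ ())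

-- M24-primitive decompositions

module Classification (R : Triple → Triple → Set) (D : IsM24PrimitiveDecomposition R) where
  open IsM24PrimitiveDecomposition D
  open IsDecomposition decomposition
  open IsEdgeEquivalence isEquiv renaming (symm to R-sym; trans to R-trans)

  Edge : Pt → Pt → Pt → Set
  Edge a b c = IsEdge (a , b , c)

  infix  4 _≈_
  infixr 5 _∙_

  _≈_ : Triple → Triple → Set
  t ≈ t′ = IsEdge t × IsEdge t′ × R t t′

  ≈-refl : ∀ {t} → IsEdge t → t ≈ t
  ≈-refl {_ , _ , _} et = et , et , wellDefined _ _ et et (refl , inj₁ (refl , refl))

  ≈-sym : ∀ {t t′} → t ≈ t′ → t′ ≈ t
  ≈-sym (et , et′ , r) = et′ , et , R-sym _ _ et et′ r

  _∙_ : ∀ {t t′ t″} → t ≈ t′ → t′ ≈ t″ → t ≈ t″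
  (et , et′ , r) ∙ (_ , et″ , r′) = et , et″ , R-trans _ _ _ et et′ et″ r r′

  ≈-swap : ∀ {a b c} → Edge a b c → (a , b , c) ≈ (a , c , b)
  ≈-swap abc@(a≢b , a≢c , b≢c) = abc , acb , wellDefined _ _ abc acb (refl , inj₂ (refl , refl))
    where
    acb : Edge _ _ _
    acb = a≢c , a≢b , ≢-sym b≢c

  ≈-swapˡ : ∀ {a b c t} → (a , b , c) ≈ t → (a , c , b) ≈ t
  ≈-swapˡ r = ≈-sym (≈-swap (proj₁ r)) ∙ r

  ≈-swapʳ : ∀ {a b c t} → t ≈ (a , b , c) → t ≈ (a , c , b)
  ≈-swapʳ r = r ∙ ≈-swap (proj₁ (proj₂ r))

  ≈-act : ∀ g {t t′} → t ≈ t′ → actT g t ≈ actT g t′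
  ≈-act g (et , et′ , r) = edge-image g et , edge-image g et′ , invariant g _ _ et et′ r

  ≈-along : ∀ g {a b c a′ b′ c′ p q s p′ q′ s′} → (a , b , c) ≈ (a′ , b′ , c′) →
            act g a ≡ p → act g b ≡ q → act g c ≡ s → act g a′ ≡ p′ → act g b′ ≡ q′ → act g c′ ≡ s′ →
            (p , q , s) ≈ (p′ , q′ , s′)
  ≈-along g r refl refl refl refl refl refl = ≈-act g r

  -- P∩, P⊖, P∪ refining R, each stated through a family of pairs that generates it.
  Coarser∩ Coarser⊖ Coarser∪ Trivial : Set
  Coarser∩ = ∀ {a b c b′ c′} → Edge a b c → Edge a b′ c′ → (a , b , c) ≈ (a , b′ , c′)
  Coarser⊖ = ∀ {a a′ b c} → Edge a b c → Edge a′ b c → (a , b , c) ≈ (a′ , b , c)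
  Coarser∪ = ∀ {a b c} → Edge a b c → (a , b , c) ≈ (b , a , c)
  Trivial  = ∀ {t t′} → IsEdge t → IsEdge t′ → t ≈ t′

  nontrivial : ¬ Trivial
  nontrivial trivial with twoParts
  ... | _ , _ , et , et′ , ¬r = ¬r (proj₂ (proj₂ (trivial et et′)))

  lastChange-everywhere : ∀ {a b c d p q s u} → (a , b , c) ≈ (a , b , d) → c ≢ d →
                          Unique (p ∷ q ∷ s ∷ u ∷ []) → (p , q , s) ≈ (p , q , u)
  lastChange-everywhere {a} {b} {c} {d} {p} {q} {s} {u}
                        r@((a≢b , a≢c , b≢c) , (_ , a≢d , b≢d) , _) c≢d pqsu
    with four-transitive (a ∷ b ∷ c ∷ d ∷ []) (p ∷ q ∷ s ∷ u ∷ [])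
           ((a≢b ∷ a≢c ∷ a≢d ∷ []) ∷ (b≢c ∷ b≢d ∷ []) ∷ (c≢d ∷ []) ∷ [] ∷ []) pqsu
  ... | g , refl ∷ refl ∷ refl ∷ refl ∷ [] = ≈-act g r

  coarser∩-of-lastChange : ∀ {a b c d} → (a , b , c) ≈ (a , b , d) → c ≢ d → Coarser∩
  coarser∩-of-lastChange r c≢d {a} {b} {c} {b′} {c′} (a≢b , a≢c , b≢c) (a≢b′ , a≢c′ , b′≢c′)
    with fresh (a ∷ b ∷ c ∷ b′ ∷ c′ ∷ [])
  ... | x , x≢a ∷ x≢b ∷ x≢c ∷ x≢b′ ∷ x≢c′ ∷ [] with fresh (a ∷ b ∷ x ∷ b′ ∷ [])
  ... | y , y≢a ∷ y≢b ∷ y≢x ∷ y≢b′ ∷ [] = c↦x ∙ ≈-swapˡ b↦y ∙ y↦b′ ∙ ≈-swapˡ x↦c′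
    where
    change : ∀ {p q s u} → Unique (p ∷ q ∷ s ∷ u ∷ []) → (p , q , s) ≈ (p , q , u)
    change = lastChange-everywhere r c≢d

    c↦x : (a , b , c) ≈ (a , b , x)
    c↦x = change ((a≢b ∷ a≢c ∷ ≢-sym x≢a ∷ []) ∷ (b≢c ∷ ≢-sym x≢b ∷ []) ∷ (≢-sym x≢c ∷ []) ∷ [] ∷ [])

    b↦y : (a , x , b) ≈ (a , x , y)
    b↦y = change ((≢-sym x≢a ∷ a≢b ∷ ≢-sym y≢a ∷ []) ∷ (x≢b ∷ ≢-sym y≢x ∷ []) ∷ (≢-sym y≢b ∷ []) ∷ [] ∷ [])

    y↦b′ : (a , x , y) ≈ (a , x , b′)
    y↦b′ = change ((≢-sym x≢a ∷ ≢-sym y≢a ∷ a≢b′ ∷ []) ∷ (≢-sym y≢x ∷ x≢b′ ∷ []) ∷ (y≢b′ ∷ []) ∷ [] ∷ [])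

    x↦c′ : (a , b′ , x) ≈ (a , b′ , c′)
    x↦c′ = change ((a≢b′ ∷ ≢-sym x≢a ∷ a≢c′ ∷ []) ∷ (≢-sym x≢b′ ∷ b′≢c′ ∷ []) ∷ (x≢c′ ∷ []) ∷ [] ∷ [])

  coarser⊖-of-centreChange : ∀ {a a′ b c} → (a , b , c) ≈ (a′ , b , c) → a ≢ a′ → Coarser⊖
  coarser⊖-of-centreChange {a} {a′} {b} {c} r@((a≢b , a≢c , b≢c) , (a′≢b , a′≢c , _) , _) a≢a′
                           {x} {x′} {y} {z} xyz@(x≢y , x≢z , y≢z) (x′≢y , x′≢z , _) with x ≟ x′
  ... | yes refl = ≈-refl xyz
  ... | no x≢x′ with four-transitive (a ∷ a′ ∷ b ∷ c ∷ []) (x ∷ x′ ∷ y ∷ z ∷ [])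
                       ((a≢a′ ∷ a≢b ∷ a≢c ∷ []) ∷ (a′≢b ∷ a′≢c ∷ []) ∷ (b≢c ∷ []) ∷ [] ∷ [])
                       ((x≢x′ ∷ x≢y ∷ x≢z ∷ []) ∷ (x′≢y ∷ x′≢z ∷ []) ∷ (y≢z ∷ []) ∷ [] ∷ [])
  ...   | g , refl ∷ refl ∷ refl ∷ refl ∷ [] = ≈-act g r

  coarser∪-of-rotation : ∀ {a b c} → (a , b , c) ≈ (b , a , c) → Coarser∪
  coarser∪-of-rotation {a} {b} {c} r@(abc , _) {p} {q} {s} pqs
    with three-transitive (a ∷ b ∷ c ∷ []) (p ∷ q ∷ s ∷ []) (edge-unique abc) (edge-unique pqs)
  ... | g , refl ∷ refl ∷ refl ∷ [] = ≈-act g r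

  trivial-of-∩⊖ : Coarser∩ → Coarser⊖ → Trivial
  trivial-of-∩⊖ ∩ ⊖ {a , _ , _} {a′ , _ , _} abc a′b′c′ with fresh (a ∷ a′ ∷ [])
  ... | p , p≢a ∷ p≢a′ ∷ [] with fresh (a ∷ a′ ∷ p ∷ [])
  ... | q , q≢a ∷ q≢a′ ∷ q≢p ∷ [] = ∩ abc apq ∙ ⊖ apq a′pq ∙ ∩ a′pq a′b′c′
    where
    apq : Edge a p q
    apq = ≢-sym p≢a , ≢-sym q≢a , ≢-sym q≢p
    a′pq : Edge a′ p q
    a′pq = ≢-sym p≢a′ , ≢-sym q≢a′ , ≢-sym q≢p

  trivial-of-∩∪ : Coarser∩ → Coarser∪ → Trivial
  trivial-of-∩∪ ∩ ∪ {a , _ , _} {a′ , _ , _} abc a′b′c′ with a ≟ a′ | fresh (a ∷ a′ ∷ [])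
  ... | yes refl | _ = ∩ abc a′b′c′
  ... | no a≢a′ | q , q≢a ∷ q≢a′ ∷ [] = ∩ abc aa′q ∙ ∪ aa′q ∙ ∩ a′aq a′b′c′
    where
    aa′q : Edge a a′ q
    aa′q = a≢a′ , ≢-sym q≢a , ≢-sym q≢a′
    a′aq : Edge a′ a q
    a′aq = ≢-sym a≢a′ , ≢-sym q≢a′ , ≢-sym q≢a

  coarser∩-of-⊖∪ : Coarser⊖ → Coarser∪ → Coarser∩
  coarser∩-of-⊖∪ ⊖ ∪ = coarser∩-of-lastChange (≈-swapˡ (≈-swapʳ 012≈032)) λ ()
    where
    012≈032 : (# 0 , # 1 , # 2) ≈ (# 0 , # 3 , # 2)
    012≈032 = ⊖ ((λ ()) , (λ ()) , (λ ())) ((λ ()) , (λ ()) , (λ ()))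
            ∙ ∪ ((λ ()) , (λ ()) , (λ ()))
            ∙ ⊖ ((λ ()) , (λ ()) , (λ ())) ((λ ()) , (λ ()) , (λ ()))

  coarser∪-of-∩ : ∀ {a b c a′ b′ c′} → Coarser∩ → (a , b , c) ≈ (a′ , b′ , c′) → a ≢ a′ → Coarser∪
  coarser∪-of-∩ {a} {a′ = a′} ∩ r@(abc , a′b′c′ , _) a≢a′ with fresh (a ∷ a′ ∷ [])
  ... | q , q≢a ∷ q≢a′ ∷ [] = coarser∪-of-rotation (∩ aa′q abc ∙ r ∙ ∩ a′b′c′ a′aq)
    where
    aa′q : Edge a a′ q
    aa′q = a≢a′ , ≢-sym q≢a , ≢-sym q≢a′
    a′aq : Edge a′ a q
    a′aq = ≢-sym a≢a′ , ≢-sym q≢a′ , ≢-sym q≢a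

  trivial-of-∩-centreChange : ∀ {a b c a′ b′ c′} → Coarser∩ → (a , b , c) ≈ (a′ , b′ , c′) → a ≢ a′ →
                              Trivial
  trivial-of-∩-centreChange ∩ r a≢a′ = trivial-of-∩∪ ∩ (coarser∪-of-∩ ∩ r a≢a′)

  coarser∩-of-sameCentre : ∀ {a b c x y} → (a , b , c) ≈ (a , x , y) → ¬ SameP⊖ (a , b , c) (a , x , y) →
                           Coarser∩
  coarser∩-of-sameCentre {a} {b} {c} {x} {y} r@(abc , (a≢x , a≢y , x≢y) , _) ¬same
    with x ≟ b | x ≟ c | y ≟ b | y ≟ c
  ... | yes refl | _        | _        | yes refl = ⊥-elim (¬same (samePair-refl a a))
  ... | yes refl | _        | _        | no y≢c   = coarser∩-of-lastChange r (≢-sym y≢c)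
  ... | no _     | yes refl | yes refl | _        = ⊥-elim (¬same (samePair-swap a a))
  ... | no _     | yes refl | no y≢b   | _        = coarser∩-of-lastChange (≈-swapˡ r) (≢-sym y≢b)
  ... | no _     | no x≢c   | yes refl | _        = coarser∩-of-lastChange (≈-swapʳ r) (≢-sym x≢c)
  ... | no x≢b   | no _     | no _     | yes refl = coarser∩-of-lastChange (≈-swapʳ (≈-swapˡ r)) (≢-sym x≢b)
  -- no common outer point: fix a, b, c, x and move y to a fresh z
  ... | no x≢b   | no x≢c   | no y≢b   | no y≢c   with fresh (a ∷ b ∷ c ∷ x ∷ y ∷ [])
  ...   | z , z≢a ∷ z≢b ∷ z≢c ∷ z≢x ∷ z≢y ∷ []
          with stabiliser-transitive (edge-unique abc) (≢-sym a≢y ∷ y≢b ∷ y≢c ∷ ≢-sym x≢y ∷ [])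
                                     (z≢a ∷ z≢b ∷ z≢c ∷ z≢x ∷ [])
  ...     | g , gy ∷ ga ∷ gb ∷ gc ∷ gx ∷ [] =
    coarser∩-of-lastChange (≈-sym r ∙ ≈-along g r ga gb gc ga gx gy) (≢-sym z≢y)

  coarser⊖-of-samePair : ∀ {a b c p x y} → (a , b , c) ≈ (p , x , y) → a ≢ p →
                         SameP⊖ (a , b , c) (p , x , y) → Coarser⊖
  coarser⊖-of-samePair r@((_ , _ , b≢c) , _) a≢p same
    with distinct-pair b≢c (to (same _) (inj₁ refl)) (to (same _) (inj₂ refl))
  ... | inj₁ (refl , refl) = coarser⊖-of-centreChange r a≢p
  ... | inj₂ (refl , refl) = coarser⊖-of-centreChange (≈-swapʳ r) a≢p

  coarser∪-of-sameTriangle : ∀ {a b c p x y} → (a , b , c) ≈ (p , x , y) → a ≢ p →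
                             SameP∪ (a , b , c) (p , x , y) → Coarser∪
  coarser∪-of-sameTriangle {x = x} {y} r@(_ , (p≢x , p≢y , x≢y) , _) a≢p same
    with from (same _) (inj₁ refl)
  ... | inj₁ refl = ⊥-elim (a≢p refl)
  ... | inj₂ (inj₁ refl)
        with distinct-pair x≢y (∈△-minus-middle (from (same x) (inj₂ (inj₁ refl))) (≢-sym p≢x))
                               (∈△-minus-middle (from (same y) (inj₂ (inj₂ refl))) (≢-sym p≢y))
  ...   | inj₁ (refl , refl) = coarser∪-of-rotation r
  ...   | inj₂ (refl , refl) = coarser∪-of-rotation (≈-swapʳ r)
  coarser∪-of-sameTriangle {x = x} {y} r@(_ , (p≢x , p≢y , x≢y) , _) a≢p same
      | inj₂ (inj₂ refl)
        with distinct-pair x≢y (∈△-minus-last (from (same x) (inj₂ (inj₁ refl))) (≢-sym p≢x))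
                               (∈△-minus-last (from (same y) (inj₂ (inj₂ refl))) (≢-sym p≢y))
  ...   | inj₁ (refl , refl) = coarser∪-of-rotation (≈-swapˡ r)
  ...   | inj₂ (refl , refl) = coarser∪-of-rotation (≈-swapˡ (≈-swapʳ r))

  coarser∩-of-newPoint : ∀ {a b c p x y} → (a , b , c) ≈ (p , x , y) → x ∉△ (a , b , c) → Coarser∩
  coarser∩-of-newPoint {a} {b} {c} {p} {x} {y} r@(abc , (p≢x , _ , x≢y) , _) x∉
    with fresh (a ∷ b ∷ c ∷ p ∷ x ∷ y ∷ [])
  ... | z , z≢a ∷ z≢b ∷ z≢c ∷ z≢p ∷ z≢x ∷ z≢y ∷ []
    with stabiliser-transitive (edge-unique abc)
           (x∉ ∘′ inj₁ ∷ x∉ ∘′ inj₂ ∘′ inj₁ ∷ x∉ ∘′ inj₂ ∘′ inj₂ ∷ ≢-sym p≢x ∷ []) (z≢a ∷ z≢b ∷ z≢c ∷ z≢p ∷ [])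
  ... | g , gx ∷ ga ∷ gb ∷ gc ∷ gp ∷ [] =
    coarser∩-of-sameCentre (≈-sym r ∙ ≈-along g r ga gb gc gp gx refl) z-new
    where
    z-new : ¬ SameP⊖ (p , x , y) (p , z , act g y)
    z-new same = [ z≢x , z≢y ]′ (from (same z) (inj₁ refl))

  coarser∩-of-outsideCentre : ∀ {a b c p} → (a , b , c) ≈ (p , a , b) → p ≢ c → Coarser∩
  coarser∩-of-outsideCentre {a} {b} {c} {p} r@((a≢b , a≢c , b≢c) , (p≢a , p≢b , _) , _) p≢c
    with four-transitive (a ∷ b ∷ c ∷ p ∷ []) (a ∷ c ∷ b ∷ p ∷ [])
           ((a≢b ∷ a≢c ∷ ≢-sym p≢a ∷ []) ∷ (b≢c ∷ ≢-sym p≢b ∷ []) ∷ (≢-sym p≢c ∷ []) ∷ [] ∷ [])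
           ((a≢c ∷ a≢b ∷ ≢-sym p≢a ∷ []) ∷ (≢-sym b≢c ∷ ≢-sym p≢c ∷ []) ∷ (≢-sym p≢b ∷ []) ∷ [] ∷ [])
  ... | g , ga ∷ gb ∷ gc ∷ gp ∷ [] =
    coarser∩-of-lastChange (≈-sym r ∙ ≈-swapˡ (≈-along g r ga gb gc gp ga gb)) b≢c

  coarser∩-of-tailInside : ∀ {a b c p x y} → (a , b , c) ≈ (p , x , y) → p ∉△ (a , b , c) →
                           x ∈△ (a , b , c) → y ∈△ (a , b , c) → ¬ SameP⊖ (a , b , c) (p , x , y) →
                           Coarser∩
  coarser∩-of-tailInside {a} {b} {c} {p} {x} {y} r@(_ , (_ , _ , x≢y) , _) p∉ x∈ y∈ ¬same = by-position x∈ y∈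
    where
    p≢b : p ≢ b
    p≢b = p∉ ∘′ inj₂ ∘′ inj₁
    p≢c : p ≢ c
    p≢c = p∉ ∘′ inj₂ ∘′ inj₂

    by-position : x ∈△ (a , b , c) → y ∈△ (a , b , c) → Coarser∩
    by-position (inj₁ refl)        (inj₂ (inj₁ refl)) = coarser∩-of-outsideCentre r p≢c
    by-position (inj₁ refl)        (inj₂ (inj₂ refl)) = coarser∩-of-outsideCentre (≈-swapˡ r) p≢b
    by-position (inj₂ (inj₁ refl)) (inj₁ refl)        = coarser∩-of-outsideCentre (≈-swapʳ r) p≢c
    by-position (inj₂ (inj₂ refl)) (inj₁ refl)        = coarser∩-of-outsideCentre (≈-swapˡ (≈-swapʳ r)) p≢b
    by-position (inj₂ (inj₁ refl)) (inj₂ (inj₂ refl)) = ⊥-elim (¬same (samePair-refl a p))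
    by-position (inj₂ (inj₂ refl)) (inj₂ (inj₁ refl)) = ⊥-elim (¬same (samePair-swap a p))
    by-position (inj₁ refl)        (inj₁ refl)        = ⊥-elim (x≢y refl)
    by-position (inj₂ (inj₁ refl)) (inj₂ (inj₁ refl)) = ⊥-elim (x≢y refl)
    by-position (inj₂ (inj₂ refl)) (inj₂ (inj₂ refl)) = ⊥-elim (x≢y refl)

  trivial-or-sameTriangle : ∀ {a b c p x y} → (a , b , c) ≈ (p , x , y) → a ≢ p →
                            ¬ SameP⊖ (a , b , c) (p , x , y) → Trivial ⊎ SameP∪ (a , b , c) (p , x , y)
  trivial-or-sameTriangle {a} {b} {c} {p} {x} {y} r a≢p ¬same
    with x ∈△? (a , b , c) | y ∈△? (a , b , c) | p ∈△? (a , b , c)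
  ... | no x∉  | _      | _      = inj₁ (trivial-of-∩-centreChange (coarser∩-of-newPoint r x∉) r a≢p)
  ... | yes _  | no y∉  | _      = inj₁ (trivial-of-∩-centreChange (coarser∩-of-newPoint (≈-swapʳ r) y∉) r a≢p)
  ... | yes x∈ | yes y∈ | no p∉  =
    inj₁ (trivial-of-∩-centreChange (coarser∩-of-tailInside r p∉ x∈ y∈ ¬same) r a≢p)
  ... | yes x∈ | yes y∈ | yes p∈ = inj₂ (triangle-exhausted (proj₁ (proj₂ r)) p∈ x∈ y∈)

  escape∩ : ∀ {t t′} → t ≈ t′ → ¬ SameP∩ t t′ → Coarser⊖ ⊎ Coarser∪ ⊎ Trivial
  escape∩ {t@(_ , _ , _)} {t′@(_ , _ , _)} r a≢p with SameP⊖.same? t t′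
  ... | yes same = inj₁ (coarser⊖-of-samePair r a≢p same)
  ... | no ¬same with trivial-or-sameTriangle r a≢p ¬same
  ...   | inj₁ trivial = inj₂ (inj₂ trivial)
  ...   | inj₂ same△   = inj₂ (inj₁ (coarser∪-of-sameTriangle r a≢p same△))

  escape⊖ : ∀ {t t′} → t ≈ t′ → ¬ SameP⊖ t t′ → Coarser∩ ⊎ Coarser∪ ⊎ Trivial
  escape⊖ {a , _ , _} {p , _ , _} r ¬same with a ≟ p
  ... | yes refl = inj₁ (coarser∩-of-sameCentre r ¬same)
  ... | no a≢p with trivial-or-sameTriangle r a≢p ¬same
  ...   | inj₁ trivial = inj₂ (inj₂ trivial)
  ...   | inj₂ same△   = inj₂ (inj₁ (coarser∪-of-sameTriangle r a≢p same△))

  escape∪ : ∀ {t t′} → t ≈ t′ → ¬ SameP∪ t t′ → Coarser∩ ⊎ Coarser⊖ ⊎ Trivial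
  escape∪ {t@(a , _ , _)} {t′@(p , _ , _)} r ¬same△ with a ≟ p | SameP⊖.same? t t′
  ... | yes refl | yes same = ⊥-elim (¬same△ (sameTriangle-of-samePair {t} {t′} refl same))
  ... | yes refl | no ¬same = inj₁ (coarser∩-of-sameCentre r ¬same)
  ... | no a≢p   | yes same = inj₂ (inj₁ (coarser⊖-of-samePair r a≢p same))
  ... | no a≢p   | no ¬same with trivial-or-sameTriangle r a≢p ¬same
  ...   | inj₁ trivial = inj₂ (inj₂ trivial)
  ...   | inj₂ same△   = ⊥-elim (¬same△ same△)

  ∩-excludes : Coarser∩ → ¬ (Coarser⊖ ⊎ Coarser∪ ⊎ Trivial)
  ∩-excludes ∩ (inj₁ ⊖)              = nontrivial (trivial-of-∩⊖ ∩ ⊖)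
  ∩-excludes ∩ (inj₂ (inj₁ ∪))       = nontrivial (trivial-of-∩∪ ∩ ∪)
  ∩-excludes ∩ (inj₂ (inj₂ trivial)) = nontrivial trivial

  ⊖-excludes : Coarser⊖ → ¬ (Coarser∩ ⊎ Coarser∪ ⊎ Trivial)
  ⊖-excludes ⊖ (inj₁ ∩)              = nontrivial (trivial-of-∩⊖ ∩ ⊖)
  ⊖-excludes ⊖ (inj₂ (inj₁ ∪))       = nontrivial (trivial-of-∩⊖ (coarser∩-of-⊖∪ ⊖ ∪) ⊖)
  ⊖-excludes ⊖ (inj₂ (inj₂ trivial)) = nontrivial trivial

  ∪-excludes : Coarser∪ → ¬ (Coarser∩ ⊎ Coarser⊖ ⊎ Trivial)
  ∪-excludes ∪ (inj₁ ∩)              = nontrivial (trivial-of-∩∪ ∩ ∪)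
  ∪-excludes ∪ (inj₂ (inj₁ ⊖))       = nontrivial (trivial-of-∩⊖ (coarser∩-of-⊖∪ ⊖ ∪) ⊖)
  ∪-excludes ∪ (inj₂ (inj₂ trivial)) = nontrivial trivial

  Refines : (Triple → Triple → Set) → Set
  Refines Q = ∀ t t′ → IsEdge t → IsEdge t′ → Q t t′ → R t t′

  Escape : (Triple → Triple → Set) → Set
  Escape Q = ∃ λ t → ∃ λ t′ → t ≈ t′ × ¬ Q t t′

  module Generated (Q : Triple → Triple → Set)
    (Q-invariant : ∀ g t t′ → Q t t′ → Q (actT g t) (actT g t′))
    (Q-sym : ∀ {t t′} → Q t t′ → Q t′ t) (Q-trans : ∀ {t t′ t″} → Q t t′ → Q t′ t″ → Q t t″)
    (Q? : ∀ t t′ → Dec (Q t t′)) where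

    data Join : Triple → Triple → Set where
      by-R  : ∀ {t t′} → R t t′ → Join t t′
      by-Q  : ∀ {t t′} → Q t t′ → Join t t′
      flip  : ∀ {t t′} → Join t t′ → Join t′ t
      chain : ∀ {t t′ t″} → IsEdge t′ → Join t t′ → Join t′ t″ → Join t t″

    join-invariant : ∀ g {t t′} → IsEdge t → IsEdge t′ → Join t t′ → Join (actT g t) (actT g t′)
    join-invariant g et et′ (by-R r)         = by-R (invariant g _ _ et et′ r)
    join-invariant g et et′ (by-Q q)         = by-Q (Q-invariant g _ _ q)
    join-invariant g et et′ (flip j)         = flip (join-invariant g et′ et j)
    join-invariant g et et′ (chain em j₁ j₂) =
      chain (edge-image g em) (join-invariant g et em j₁) (join-invariant g em et′ j₂)

    join-isEdgeEquivalence : IsEdgeEquivalence Join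
    join-isEdgeEquivalence = record
      { wellDefined = λ t t′ et et′ same → by-R (wellDefined t t′ et et′ same)
      ; symm        = λ _ _ _ _ → flip
      ; trans       = λ _ _ _ _ em _ → chain em
      }

    escape : ∀ {t t′} → IsEdge t → IsEdge t′ → Join t t′ → ¬ Q t t′ → Escape Q
    escape et et′ (by-R r) ¬q = _ , _ , (et , et′ , r) , ¬q
    escape et et′ (by-Q q) ¬q = ⊥-elim (¬q q)
    escape et et′ (flip j) ¬q = escape et′ et j (¬q ∘′ Q-sym)
    escape {t} et et′ (chain {t′ = m} em j₁ j₂) ¬q with Q? t m
    ... | yes q  = escape em et′ j₂ (¬q ∘′ Q-trans q)
    ... | no ¬q′ = escape et em j₁ ¬q′

    refines-or-escapes : ∀ t t′ → IsEdge t → IsEdge t′ → ¬ Q t t′ → Refines Q ⊎ Escape Q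
    refines-or-escapes _ _ et et′ ¬q
      with proj₂ isPrimitive Join join-isEdgeEquivalence (λ _ _ _ _ → by-R) (λ g _ _ → join-invariant g)
    ... | inj₁ join⊆R = inj₁ λ t t′ et et′ q → join⊆R t t′ et et′ (by-Q q)
    ... | inj₂ total  = inj₂ (escape et et′ (total _ _ et et′) ¬q)

    partition : Refines Q → (∀ {t t′} → t ≈ t′ → ¬ ¬ Q t t′) → SamePartition R Q
    partition Q⊆R stable t t′ et et′ =
      mk⇔ (λ r → decidable-stable (Q? t t′) (stable (et , et′ , r))) (Q⊆R t t′ et et′)

  module P∩ = Generated SameP∩ (λ g _ _ → cong (act g)) sym trans (λ t t′ → proj₁ t ≟ proj₁ t′)
  module P⊖ = Generated SameP⊖ SameP⊖.same-invariant (λ {t} {t′} → SameP⊖.same-sym {t} {t′})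
                (λ {t} {t′} {t″} → SameP⊖.same-trans {t} {t′} {t″}) SameP⊖.same?
  module P∪ = Generated SameP∪ SameP∪.same-invariant (λ {t} {t′} → SameP∪.same-sym {t} {t′})
                (λ {t} {t′} {t″} → SameP∪.same-trans {t} {t′} {t″}) SameP∪.same?

  partition∩ : Refines SameP∩ → SamePartition R SameP∩
  partition∩ ∩⊆R = P∩.partition ∩⊆R λ r → ∩-excludes coarser∩ ∘′ escape∩ r
    where
    coarser∩ : Coarser∩
    coarser∩ abc ab′c′ = abc , ab′c′ , ∩⊆R _ _ abc ab′c′ refl

  partition⊖ : Refines SameP⊖ → SamePartition R SameP⊖
  partition⊖ ⊖⊆R = P⊖.partition ⊖⊆R λ r → ⊖-excludes coarser⊖ ∘′ escape⊖ r
    where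
    coarser⊖ : Coarser⊖
    coarser⊖ {a} {a′} abc a′bc = abc , a′bc , ⊖⊆R _ _ abc a′bc (samePair-refl a a′)

  partition∪ : Refines SameP∪ → SamePartition R SameP∪
  partition∪ ∪⊆R = P∪.partition ∪⊆R λ r → ∪-excludes coarser∪ ∘′ escape∪ r
    where
    coarser∪ : Coarser∪
    coarser∪ abc@(a≢b , a≢c , b≢c) = abc , bac , ∪⊆R _ _ abc bac sameTriangle-rotate
      where
      bac : Edge _ _ _
      bac = ≢-sym a≢b , b≢c , a≢c

  no-escape-from-all : Escape SameP∩ → Escape SameP⊖ → Escape SameP∪ → ⊥
  no-escape-from-all (_ , _ , r∩ , ¬∩) (_ , _ , r⊖ , ¬⊖) (_ , _ , r∪ , ¬∪) with escape∩ r∩ ¬∩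
  ... | inj₁ ⊖              = ⊖-excludes ⊖ (escape⊖ r⊖ ¬⊖)
  ... | inj₂ (inj₁ ∪)       = ∪-excludes ∪ (escape∪ r∪ ¬∪)
  ... | inj₂ (inj₂ trivial) = nontrivial trivial

  classification : SamePartition R SameP∩ ⊎ SamePartition R SameP⊖ ⊎ SamePartition R SameP∪
  classification
    with P∩.refines-or-escapes t₀₁₂ t₁₀₂ edge₀₁₂ edge₁₀₂ (λ ())
       | P⊖.refines-or-escapes t₀₁₂ t₀₁₃ edge₀₁₂ edge₀₁₃ (from-no (SameP⊖.same? t₀₁₂ t₀₁₃))
       | P∪.refines-or-escapes t₀₁₂ t₀₁₃ edge₀₁₂ edge₀₁₃ (from-no (SameP∪.same? t₀₁₂ t₀₁₃))
  ... | inj₁ ∩⊆R | _        | _        = inj₁ (partition∩ ∩⊆R)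
  ... | inj₂ _   | inj₁ ⊖⊆R | _        = inj₂ (inj₁ (partition⊖ ⊖⊆R))
  ... | inj₂ _   | inj₂ _   | inj₁ ∪⊆R = inj₂ (inj₂ (partition∪ ∪⊆R))
  ... | inj₂ e∩  | inj₂ e⊖  | inj₂ e∪  = ⊥-elim (no-escape-from-all e∩ e⊖ e∪)

proposition7p10 : (R : Triple → Triple → Set) →
    IsM24PrimitiveDecomposition R →
    SamePartition R SameP∩ ⊎ SamePartition R SameP⊖ ⊎ SamePartition R SameP∪
proposition7p10 R D = Classification.classification R D
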